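{- Let $y>1$ be an integer and suppose $(n_1,m_1,a_1)$ and $(n_2,m_2,a_2)$ are two integer solutions of $F_n+F_m=y^a$ with $n>m>1$ and $a>0$, such that $a_1<a_2$. Then $n_1<n_2$.
   Context: $F_n$ denotes the $n$-th Fibonacci number ($F_0=0$, $F_1=1$, $F_{n+2}=F_{n+1}+F_n$). -}

module Defs where

open import Data.Nat using (ℕ; zero; suc; _+_)

F : ℕ → ℕ
F zero = 0
F (suc zero) = 1
F (suc (suc n)) = F (suc n) + F n

{-# OPTIONS --safe #-}
module Submission where

-- For 0 < m < n the sum F n + F m lies in the half-open interval (F (1 + n) / 2, F (1 + n)],
-- while distinct powers of y ≥ 2 differ at least by a factor 2; so a larger power forces a larger n.

open import Defs
open import Data.Nat using (ℕ; zero; suc; _+_; _*_; _^_; _≤_; _<_; _≤′_; ≤′-refl; ≤′-step; z≤n; s≤s)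
open import Data.Nat.Properties
open import Relation.Binary.PropositionalEquality using (_≡_; refl; sym; cong; cong₂)
open import Relation.Nullary using (yes; no; contradiction)

F-≤-F[1+n] : ∀ n → F n ≤ F (suc n)
F-≤-F[1+n] zero          = z≤n
F-≤-F[1+n] (suc zero)    = ≤-refl
F-≤-F[1+n] (suc (suc n)) = m≤m+n (F (suc (suc n))) (F (suc n))

F-mono-≤ : ∀ {m n} → m ≤ n → F m ≤ F n
F-mono-≤ m≤n = F-mono-≤′ (≤⇒≤′ m≤n)
  where
  F-mono-≤′ : ∀ {m n} → m ≤′ n → F m ≤ F n
  F-mono-≤′ ≤′-refl                 = ≤-refl
  F-mono-≤′ {n = suc n} (≤′-step p) = ≤-trans (F-mono-≤′ p) (F-≤-F[1+n] n)

F-pos : ∀ {n} → 0 < n → 0 < F n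
F-pos = F-mono-≤

F[1+n]≤F[n]+F[n] : ∀ {n} → 0 < n → F (suc n) ≤ F n + F n
F[1+n]≤F[n]+F[n] {suc n} _ = +-monoʳ-≤ (F (suc n)) (F-≤-F[1+n] n)

F[n]+F[m]≤F[1+n] : ∀ {m n} → m < n → F n + F m ≤ F (suc n)
F[n]+F[m]≤F[1+n] {n = suc n} (s≤s m≤n) = +-monoʳ-≤ (F (suc n)) (F-mono-≤ m≤n)

F[1+n]<2[F[n]+F[m]] : ∀ {m n} → 0 < m → m ≤ n → F (suc n) < (F n + F m) + (F n + F m)
F[1+n]<2[F[n]+F[m]] {m} {n} 0<m m≤n =
  ≤-<-trans (F[1+n]≤F[n]+F[n] (≤-trans 0<m m≤n)) (+-mono-< Fn<Fn+Fm Fn<Fn+Fm)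
  where
  Fn<Fn+Fm : F n < F n + F m
  Fn<Fn+Fm = m<m+n (F n) (F-pos 0<m)

x^a+x^a≤x^b : ∀ {x a b} → 1 < x → a < b → x ^ a + x ^ a ≤ x ^ b
x^a+x^a≤x^b {x@(suc _)} {a} {b} 1<x a<b = begin
  x ^ a + x ^ a       ≡⟨ cong (x ^ a +_) (sym (+-identityʳ (x ^ a))) ⟩
  2 * x ^ a           ≤⟨ *-monoˡ-≤ (x ^ a) 1<x ⟩
  x ^ suc a           ≤⟨ ^-monoʳ-≤ x a<b ⟩
  x ^ b               ∎
  where open ≤-Reasoning

lemma5p1 : (y n₁ m₁ a₁ n₂ m₂ a₂ : ℕ) → 1 < y →
           1 < m₁ → m₁ < n₁ → 0 < a₁ → F n₁ + F m₁ ≡ y ^ a₁ →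
           1 < m₂ → m₂ < n₂ → 0 < a₂ → F n₂ + F m₂ ≡ y ^ a₂ →
           a₁ < a₂ → n₁ < n₂
lemma5p1 y n₁ m₁ a₁ n₂ m₂ a₂ 1<y 1<m₁ m₁<n₁ _ e₁ _ m₂<n₂ _ e₂ a₁<a₂ with n₂ ≤? n₁
... | no n₂≰n₁  = ≰⇒> n₂≰n₁
... | yes n₂≤n₁ = contradiction y^a₂<y^a₂ (<-irrefl refl)
  where
  open ≤-Reasoning
  y^a₂<y^a₂ : y ^ a₂ < y ^ a₂
  y^a₂<y^a₂ = begin-strict
    y ^ a₂                        ≡⟨ sym e₂ ⟩
    F n₂ + F m₂                   ≤⟨ F[n]+F[m]≤F[1+n] m₂<n₂ ⟩
    F (suc n₂)                    ≤⟨ F-mono-≤ (s≤s n₂≤n₁) ⟩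
    F (suc n₁)                    <⟨ F[1+n]<2[F[n]+F[m]] (<⇒≤ 1<m₁) (<⇒≤ m₁<n₁) ⟩
    (F n₁ + F m₁) + (F n₁ + F m₁) ≡⟨ cong₂ _+_ e₁ e₁ ⟩
    y ^ a₁ + y ^ a₁               ≤⟨ x^a+x^a≤x^b 1<y a₁<a₂ ⟩
    y ^ a₂                        ∎
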